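{- Let $m\in\mathbb Z_{\ge0}$, let $(\lambda/\mu,r)$ be an r-shape, $n\ge\lambda_1$, and let $\mathbf a,\mathbf b\in\mathbb Z^n$ be column flags with conjugate flags $\mathbf a',\mathbf b'$. Put $\tau(k)=-k+1$, $\eta(k)=k-m$, $u_j=\max(1,a_j)$, $v_i=\min(m,b_i)$. Then $$\mathsf g^{\mathbf a,\mathbf b}_{\lambda/\mu}(\mathbf x_m;\boldsymbol\alpha,\boldsymbol\beta)=\det\Big[e_{\lambda'_i-i-\mu'_j+j}\big(\mathbf x_{u_j,v_i},\overline{\boldsymbol\alpha}_{\tau(b_i),\tau(a_j)},\boldsymbol\beta_{\eta(a_j),\eta(b_i)}\,/\,\overline{\boldsymbol\alpha}_{\eta(a'_j),\eta(b'_i)},\boldsymbol\beta_{\tau(b'_i),\tau(a'_j)}\big)\Big]_{1\le i,j\le n},$$ where $\alpha_i=\beta_i=0$ for $i\le0$. In particular, if $\lambda/\mu$ is a usual shape and $a_i=-i+2$, $b_i=\lambda'_i+m-1$ for $i\in[n]$, then $\mathsf S^{\mathbf a,\mathbf b}_{\lambda/\mu}(\mathbf y/\mathbf z)|_g=\mathsf g^{\mathbf a,\mathbf b}_{\lambda/\mu}(\mathbf x_m;\boldsymbol\alpha,\boldsymbol\beta)=g_{\lambda/\mu}(\mathbf x_m;\boldsymbol\alpha,\boldsymbol\beta)$.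
   Context: Partitions, conjugates $\lambda',\mu'$, skew diagram $\lambda/\mu=\{(i,j):\mu_i<j\le\lambda_i\}$ (English notation). An r-shape $(\lambda/\mu,r)$: skew diagram with integer $r$; content of $(i,j)$ is $c(i,j)=j-i+r-1+\lambda'_1$; the usual shape has $c(i,j)=j-i$. Supersymmetric functions of finite variable sets: $e_n(\mathbf x/\mathbf y)=\sum_{i=0}^n(-1)^{n-i}e_i(\mathbf x)h_{n-i}(\mathbf y)$ ($0$ for $n<0$); a comma between variable sets denotes their union. For a sequence $\mathbf w$, $\mathbf w_{p,q}=(w_p,\dots,w_q)$ if $p\le q$ and empty otherwise, $\mathbf w_k=\mathbf w_{1,k}$, $\overline{\mathbf w}=(-w_i)$. Column flags: $\mathbf a,\mathbf b\in\mathbb Z^n$ with $a_i-a_{i+1}\le\mu'_i-\mu'_{i+1}+1$, $b_i-b_{i+1}\le\lambda'_i-\lambda'_{i+1}+1$ whenever $\mu'_i<\lambda'_{i+1}$; conjugate flags $a'_i=a_i+c(\mu'_i+1,i)$, $b'_i=b_i+c(\lambda'_i,i)$. For $\mathbf y=(y_i)_{i\in\mathbb Z},\mathbf z=(z_i)_{i\in\mathbb Z}$: $\mathsf S^{\mathbf a,\mathbf b}_{\lambda/\mu}(\mathbf y/\mathbf z)=\det[e_{\lambda'_i-i-\mu'_j+j}(\mathbf y_{a_j,b_i}/\mathbf z_{a'_j,b'_i})]_{1\le i,j\le n}$. The $g$-specialization (for given $m$) substitutes $y_i\mapsto x_i$ ($i\in[m]$), $y_i\mapsto\beta_{i-m}$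 ($i>m$), $y_i\mapsto-\alpha_{ -i+1}$ ($i\le0$); $z_i\mapsto0$ ($i\in[m]$), $z_i\mapsto-\alpha_{i-m}$ ($i>m$), $z_i\mapsto\beta_{ -i+1}$ ($i\le0$). The flagged dual Grothendieck enumerator is $\mathsf g^{\mathbf a,\mathbf b}_{\lambda/\mu}(\mathbf x_m;\boldsymbol\alpha,\boldsymbol\beta)=\mathsf S^{\mathbf a,\mathbf b}_{\lambda/\mu}(\mathbf y/\mathbf z)|_g$. The dual refined canonical stable Grothendieck polynomial is $g_{\lambda/\mu}(\mathbf x_m;\boldsymbol\alpha,\boldsymbol\beta)=\det[e_{\lambda'_i-i-\mu'_j+j}(\mathbf x_m,\overline{\boldsymbol\alpha}_{j-1},\boldsymbol\beta_{\lambda'_i-1}/\overline{\boldsymbol\alpha}_{i-1},\boldsymbol\beta_{\mu'_j})]_{1\le i,j\le n}$, $n\ge\lambda_1$. -}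

module Defs where

open import Level using (Level)
open import Data.Nat as ℕ using (ℕ; zero; suc)
open import Data.Integer as ℤ using (ℤ; +_; -[1+_])
open import Data.Bool using (if_then_else_)
open import Data.List using (List; []; _∷_; _++_; map; length; filter)
open import Data.List.Relation.Unary.All using (All)
open import Data.List.Relation.Unary.Linked using (Linked)
open import Data.Fin using (Fin; toℕ; punchIn) renaming (zero to fzero; suc to fsuc)
open import Data.Product using (_×_)
open import Algebra.Bundles using (CommutativeRing)

IsPartition : List ℕ → Set
IsPartition l = Linked ℕ._≥_ l × All (0 ℕ.<_) l

-- part l i = l_i  (1-indexed; 0 beyond the length)
part : List ℕ → ℕ → ℕ
part []       _             = 0
part (x ∷ xs) zero          = 0   -- unused (indices start at 1)
part (x ∷ xs) (suc zero)    = x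
part (x ∷ xs) (suc (suc i)) = part xs (suc i)

conj : List ℕ → ℕ → ℕ
conj l j = length (filter (λ p → j ℕ.≤? p) l)

_⊆ₚ_ : List ℕ → List ℕ → Set
mu ⊆ₚ lam = ∀ i → part mu i ℕ.≤ part lam i

content : List ℕ → ℤ → ℤ → ℤ → ℤ
content lam r i j = j ℤ.- i ℤ.+ r ℤ.- ℤ.+ 1 ℤ.+ ℤ.+ conj lam 1

-- flags a b : ℤ^n, stored as 1-indexed functions ℕ → ℤ (only 1..n used)
ColumnFlags : List ℕ → List ℕ → ℕ → (ℕ → ℤ) → (ℕ → ℤ) → Set
ColumnFlags lam mu n a b =
  ∀ i → 1 ℕ.≤ i → i ℕ.< n → conj mu i ℕ.< conj lam (suc i) →
    (a i ℤ.- a (suc i) ℤ.≤ (+ conj mu i) ℤ.- (+ conj mu (suc i)) ℤ.+ ℤ.+ 1)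
  × (b i ℤ.- b (suc i) ℤ.≤ (+ conj lam i) ℤ.- (+ conj lam (suc i)) ℤ.+ ℤ.+ 1)

conjFlagA : List ℕ → List ℕ → ℤ → (ℕ → ℤ) → ℕ → ℤ
conjFlagA lam mu r a i = a i ℤ.+ content lam r (+ suc (conj mu i)) (+ i)

conjFlagB : List ℕ → ℤ → (ℕ → ℤ) → ℕ → ℤ
conjFlagB lam r b i = b i ℤ.+ content lam r (+ conj lam i) (+ i)

rangeFrom : ℤ → ℕ → List ℤ
rangeFrom p zero    = []
rangeFrom p (suc k) = p ∷ rangeFrom (p ℤ.+ ℤ.+ 1) k

range : ℤ → ℤ → List ℤ
range p q with q ℤ.- p
... | + k      = rangeFrom p (suc k)
... | -[1+ _ ] = []

module _ {c ℓ : Level} (R : CommutativeRing c ℓ) where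
  open CommutativeRing R hiding (zero)

  sub : (ℤ → Carrier) → ℤ → ℤ → List Carrier
  sub w p q = map w (range p q)

  ext : (ℕ → Carrier) → ℤ → Carrier
  ext w (+ zero)  = 0#
  ext w (+ suc k) = w (suc k)
  ext w -[1+ _ ]  = 0#

  neg : List Carrier → List Carrier
  neg = map (-_)

  sign : ℕ → Carrier
  sign zero    = 1#
  sign (suc k) = - sign k

  elem : ℕ → List Carrier → Carrier
  elem zero    _        = 1#
  elem (suc k) []       = 0#
  elem (suc k) (x ∷ xs) = elem (suc k) xs + x * elem k xs

  hom : List Carrier → ℕ → Carrier
  hom _        zero    = 1#
  hom []       (suc k) = 0#
  hom (x ∷ xs) (suc k) = hom xs (suc k) + x * hom (x ∷ xs) k

  sumTo : (ℕ → Carrier) → ℕ → Carrier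
  sumTo f zero    = f zero
  sumTo f (suc k) = sumTo f k + f (suc k)

  esup : ℤ → List Carrier → List Carrier → Carrier
  esup (+ k)    X Y = sumTo (λ i → sign (k ℕ.∸ i) * elem i X * hom Y (k ℕ.∸ i)) k
  esup -[1+ _ ] X Y = 0#

  sumFin : ∀ {n} → (Fin n → Carrier) → Carrier
  sumFin {zero}  f = 0#
  sumFin {suc n} f = f fzero + sumFin (λ j → f (fsuc j))

  det : ∀ n → (Fin n → Fin n → Carrier) → Carrier
  det zero    M = 1#
  det (suc n) M = sumFin (λ j → sign (toℕ j) * M fzero j
                                  * det n (λ i k → M (fsuc i) (punchIn j k)))

  ix : ∀ {n} → Fin n → ℕ
  ix i = suc (toℕ i)

  degree : List ℕ → List ℕ → ℕ → ℕ → ℤ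
  degree lam mu i j = (+ conj lam i) ℤ.- (+ i) ℤ.- (+ conj mu j) ℤ.+ (+ j)

  flaggedS : List ℕ → List ℕ → ℤ → ℕ → (ℕ → ℤ) → (ℕ → ℤ)
           → (ℤ → Carrier) → (ℤ → Carrier) → Carrier
  flaggedS lam mu r n a b y z = det n (λ i j →
    esup (degree lam mu (ix i) (ix j))
         (sub y (a (ix j)) (b (ix i)))
         (sub z (conjFlagA lam mu r a (ix j)) (conjFlagB lam r b (ix i))))

  ySpec : ℕ → (x α β : ℕ → Carrier) → ℤ → Carrier
  ySpec m x α β (+ zero)   = - α 1
  ySpec m x α β -[1+ k ]   = - α (suc (suc k))
  ySpec m x α β (+ suc k)  =
    if suc k ℕ.≤ᵇ m then x (suc k) else β (suc k ℕ.∸ m)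

  zSpec : ℕ → (x α β : ℕ → Carrier) → ℤ → Carrier
  zSpec m x α β (+ zero)   = β 1
  zSpec m x α β -[1+ k ]   = β (suc (suc k))
  zSpec m x α β (+ suc k)  =
    if suc k ℕ.≤ᵇ m then 0# else - α (suc k ℕ.∸ m)

  gFlag : List ℕ → List ℕ → ℤ → ℕ → (ℕ → ℤ) → (ℕ → ℤ) → ℕ
        → (x α β : ℕ → Carrier) → Carrier
  gFlag lam mu r n a b m x α β =
    flaggedS lam mu r n a b (ySpec m x α β) (zSpec m x α β)

  gFlagRHS : List ℕ → List ℕ → ℤ → ℕ → (ℕ → ℤ) → (ℕ → ℤ) → ℕ
           → (x α β : ℕ → Carrier) → Carrier
  gFlagRHS lam mu r n a b m x α β = det n (λ i j →
    let ai  = a (ix j)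
        bi  = b (ix i)
        ai' = conjFlagA lam mu r a (ix j)
        bi' = conjFlagB lam r b (ix i)
        τ   = λ (k : ℤ) → ℤ.- k ℤ.+ ℤ.+ 1
        η   = λ (k : ℤ) → k ℤ.- ℤ.+ m
        u   = ℤ.+ 1 ℤ.⊔ ai
        v   = ℤ.+ m ℤ.⊓ bi
    in esup (degree lam mu (ix i) (ix j))
            (sub (ext x) u v ++ neg (sub (ext α) (τ bi) (τ ai))
                             ++ sub (ext β) (η ai) (η bi))
            (neg (sub (ext α) (η ai') (η bi')) ++ sub (ext β) (τ bi') (τ ai')))

  gDual : List ℕ → List ℕ → ℕ → ℕ → (x α β : ℕ → Carrier) → Carrier
  gDual lam mu n m x α β = det n (λ i j →
    esup (degree lam mu (ix i) (ix j))
         (sub (ext x) (ℤ.+ 1) (ℤ.+ m)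
            ++ neg (sub (ext α) (ℤ.+ 1) (ℤ.+ ix j ℤ.- ℤ.+ 1))
            ++ sub (ext β) (ℤ.+ 1) (ℤ.+ conj lam (ix i) ℤ.- ℤ.+ 1))
         (neg (sub (ext α) (ℤ.+ 1) (ℤ.+ ix i ℤ.- ℤ.+ 1))
            ++ sub (ext β) (ℤ.+ 1) (ℤ.+ conj mu (ix j))))

-- Under the g-specialisation each interval y_{p,q} is a piecewise sequence: -α reflected by τ
-- on indices ≤ 0, x on [1, m] and β shifted by η above m (and z likewise with β, 0, -α). Since
-- e_k(X/Y) is symmetric in X and in Y and ignores zero variables, an induction on q splits
-- y_{p,q} and z_{p,q} into the three intervals of the right-hand side, entry by entry.
-- For the standard flags and r = 1 - λ'₁ those intervals are, after dropping the indices ≤ 0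
-- where α and β vanish, exactly the variable sets of g_{λ/μ}; this settles the rows i ≤ λ₁.
-- In the remaining rows λ'ᵢ = μ'ᵢ = 0, so both matrices vanish below the diagonal there and
-- have 1 on it, and a Laplace expansion along the first λ₁ rows identifies the determinants.

module Submission where

open import Defs
open import Data.Nat as ℕ using (ℕ)
open import Data.Integer as ℤ using (ℤ)
open import Data.List using (List)
open import Data.Product using (_×_; _,_)
open import Relation.Binary.PropositionalEquality using (_≡_)
open import Algebra.Bundles using (CommutativeRing)


module IntegerRange where
  open import Data.Nat using (zero; suc; z≤n)
  open import Data.Integer using (+_; -[1+_]; _+_; _-_; -_; _≤_; _<_; +≤+)
  import Data.Integer.Properties as ℤP
  open import Data.Integer.Tactic.RingSolver using (solve-∀)
  open import Data.List using ([]; _∷_; _++_)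
  open import Data.Product using (∃)
  open import Relation.Binary.PropositionalEquality
  open import Relation.Nullary using (contradiction)
  open import Function using (case_of_)

  i<i+1 : ∀ i → i < i + + 1
  i<i+1 i = ℤP.suc[i]≤j⇒i<j (ℤP.≤-reflexive (ℤP.+-comm (+ 1) i))

  i-1<i : ∀ i → i - + 1 < i
  i-1<i i = ℤP.i≤pred[j]⇒i<j (ℤP.≤-reflexive (ℤP.+-comm i -[1+ 0 ]))

  i<j⇒i≤j-1 : ∀ {i j} → i < j → i ≤ j - + 1
  i<j⇒i≤j-1 {i} {j} i<j = ℤP.≤-trans (ℤP.i<j⇒i≤pred[j] i<j) (ℤP.≤-reflexive (ℤP.+-comm -[1+ 0 ] j))

  private
    split-diff : ∀ p q → q ≡ p + (q - p)
    split-diff = solve-∀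

    diff-suc : ∀ p q → q - (p + + 1) ≡ (q - p) - + 1
    diff-suc = solve-∀

    diff-pred : ∀ p q → (q - + 1) - p ≡ (q - p) - + 1
    diff-pred = solve-∀

    diff≡+⇒≤ : ∀ {p q k} → q - p ≡ + k → p ≤ q
    diff≡+⇒≤ eq = ℤP.0≤i-j⇒j≤i (subst (+ 0 ≤_) (sym eq) (+≤+ z≤n))

    diff≡0⇒≡ : ∀ p q → q - p ≡ + 0 → q ≡ p
    diff≡0⇒≡ p q eq = trans (split-diff p q) (trans (cong (λ t → p + t) eq) (ℤP.+-identityʳ p))

    ≤⇒diff≡+ : ∀ {p q} → p ≤ q → ∃ λ k → q - p ≡ + k
    ≤⇒diff≡+ {p} {q} p≤q with q - p | ℤP.i≤j⇒0≤j-i p≤q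
    ... | + k | _ = k , refl

  range-of-length : ∀ p q {k} → q - p ≡ + k → range p q ≡ rangeFrom p (suc k)
  range-of-length p q eq with q - p | eq
  ... | _ | refl = refl

  range-empty : ∀ {p q} → q < p → range p q ≡ []
  range-empty {p} {q} q<p with q - p in eq
  ... | -[1+ _ ] = refl
  ... | + k      = contradiction (diff≡+⇒≤ eq) (ℤP.<⇒≱ q<p)

  rangeFrom-snoc : ∀ p k → rangeFrom p (suc k) ≡ rangeFrom p k ++ (p + + k) ∷ []
  rangeFrom-snoc p zero    = cong (_∷ []) (sym (ℤP.+-identityʳ p))
  rangeFrom-snoc p (suc k) = cong (p ∷_) (trans (rangeFrom-snoc (p + + 1) k)
    (cong (λ t → rangeFrom (p + + 1) k ++ t ∷ []) (ℤP.+-assoc p (+ 1) (+ k))))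

  range-cons : ∀ {p q} → p ≤ q → range p q ≡ p ∷ range (p + + 1) q
  range-cons {p} {q} p≤q with ≤⇒diff≡+ p≤q
  ... | zero , eq = trans (range-of-length p q eq) (cong (p ∷_) (sym (range-empty
        (subst (λ t → t < p + + 1) (sym (diff≡0⇒≡ p q eq)) (i<i+1 p)))))
  ... | suc k , eq = trans (range-of-length p q eq)
        (cong (p ∷_) (sym (range-of-length (p + + 1) q (trans (diff-suc p q) (cong (λ t → t - + 1) eq)))))

  range-snoc : ∀ {p q} → p ≤ q → range p q ≡ range p (q - + 1) ++ q ∷ []
  range-snoc {p} {q} p≤q with ≤⇒diff≡+ p≤q
  ... | zero , eq = trans (range-of-length p q eq) (cong₂ (λ s t → s ++ t ∷ [])
        (sym (range-empty (subst (λ t → t - + 1 < p) (sym (diff≡0⇒≡ p q eq)) (i-1<i p))))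
        (sym (diff≡0⇒≡ p q eq)))
  ... | suc k , eq = trans (range-of-length p q eq) (trans (rangeFrom-snoc p (suc k))
        (cong₂ (λ s t → s ++ t ∷ [])
          (sym (range-of-length p (q - + 1) (trans (diff-pred p q) (cong (λ t → t - + 1) eq))))
          (sym (trans (split-diff p q) (cong (λ t → p + t) eq)))))

  range-ind : ∀ {ℓ} (P : ℤ → ℤ → Set ℓ) →
    (∀ {p q} → q < p → P p q) →
    (∀ {p q} → p ≤ q → P p (q - + 1) → P p q) →
    ∀ p q → P p q
  range-ind P empty snoc p q with q - p in eq
  ... | + k      = go k eq
    where
    go : ∀ {q} k → q - p ≡ + k → P p q
    go {q} zero    eq = snoc (diff≡+⇒≤ eq)
      (empty (subst (λ t → t - + 1 < p) (sym (diff≡0⇒≡ p q eq)) (i-1<i p)))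
    go {q} (suc k) eq = snoc (diff≡+⇒≤ eq) (go k (trans (diff-pred p q) (cong (λ t → t - + 1) eq)))
  ... | -[1+ _ ] = empty (ℤP.≰⇒> λ p≤q → case subst (+ 0 ≤_) eq (ℤP.i≤j⇒0≤j-i p≤q) of λ ())

  τ : ℤ → ℤ
  τ k = - k + + 1

  η : ℕ → ℤ → ℤ
  η m k = k - + m

  τ-antitone : ∀ {a b} → b < a → τ a < τ b
  τ-antitone b<a = ℤP.+-monoˡ-< (+ 1) (ℤP.neg-mono-< b<a)

  η-monotone : ∀ m {a b} → a < b → η m a < η m b
  η-monotone m a<b = ℤP.+-monoˡ-< (- + m) a<b

  τ-pred : ∀ b → τ b + + 1 ≡ τ (b - + 1)
  τ-pred = identity
    where
    identity : ∀ b → - b + + 1 + + 1 ≡ - (b - + 1) + + 1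
    identity = solve-∀

  η-pred : ∀ m b → η m b - + 1 ≡ η m (b - + 1)
  η-pred m = sub-comm (+ m)
    where
    sub-comm : ∀ c b → b - c - + 1 ≡ b - + 1 - c
    sub-comm = solve-∀

module BagModuloZeros {c ℓ} (R : CommutativeRing c ℓ) where
  open import Level using (_⊔_)
  open import Data.Nat using (zero; suc; _∸_)
  open import Data.Integer using (+_; -[1+_])
  open import Data.List using ([]; _∷_; _++_; map)
  import Data.List.Properties as ListP
  import Relation.Binary.PropositionalEquality as ≡
  open import Relation.Binary.Bundles using (Setoid)
  import Relation.Binary.Reasoning.Setoid
  open CommutativeRing R hiding (zero)
  open import Algebra.Solver.Ring.NaturalCoefficients.Default commutativeSemiring
  open import Algebra.Properties.Ring ring using (-0#≈0#)
  open import Algebra.Properties.Group +-group using (∙-cancelʳ)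

  -- Equality of multisets after discarding zero entries: e_k and h_k only see this.
  infix 4 _≋_
  data _≋_ : List Carrier → List Carrier → Set (c ⊔ ℓ) where
    []      : [] ≋ []
    _∷_     : ∀ {x y xs ys} → x ≈ y → xs ≋ ys → x ∷ xs ≋ y ∷ ys
    swap    : ∀ {x y xs} → x ∷ y ∷ xs ≋ y ∷ x ∷ xs
    drop-0  : ∀ {z xs} → z ≈ 0# → z ∷ xs ≋ xs
    ≋-sym   : ∀ {xs ys} → xs ≋ ys → ys ≋ xs
    ≋-trans : ∀ {xs ys zs} → xs ≋ ys → ys ≋ zs → xs ≋ zs

  ≋-refl : ∀ {xs} → xs ≋ xs
  ≋-refl {[]}     = []
  ≋-refl {x ∷ xs} = refl ∷ ≋-refl

  ≋-reflexive : ∀ {xs ys} → xs ≡ ys → xs ≋ ys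
  ≋-reflexive ≡.refl = ≋-refl

  ≋-setoid : Setoid c (c ⊔ ℓ)
  ≋-setoid = record
    { Carrier       = List Carrier
    ; _≈_           = _≋_
    ; isEquivalence = record { refl = ≋-refl ; sym = ≋-sym ; trans = ≋-trans }
    }

  ++⁺ˡ : ∀ {xs ys} zs → xs ≋ ys → xs ++ zs ≋ ys ++ zs
  ++⁺ˡ zs []            = ≋-refl
  ++⁺ˡ zs (e ∷ p)       = e ∷ ++⁺ˡ zs p
  ++⁺ˡ zs swap          = swap
  ++⁺ˡ zs (drop-0 z)    = drop-0 z
  ++⁺ˡ zs (≋-sym p)     = ≋-sym (++⁺ˡ zs p)
  ++⁺ˡ zs (≋-trans p q) = ≋-trans (++⁺ˡ zs p) (++⁺ˡ zs q)

  ++⁺ʳ : ∀ xs {ys zs} → ys ≋ zs → xs ++ ys ≋ xs ++ zs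
  ++⁺ʳ []       p = p
  ++⁺ʳ (x ∷ xs) p = refl ∷ ++⁺ʳ xs p

  ++⁺ : ∀ {ws xs ys zs} → ws ≋ xs → ys ≋ zs → ws ++ ys ≋ xs ++ zs
  ++⁺ {xs = xs} {ys} p q = ≋-trans (++⁺ˡ ys p) (++⁺ʳ xs q)

  shift : ∀ xs e ys → xs ++ e ∷ ys ≋ e ∷ xs ++ ys
  shift []       e ys = ≋-refl
  shift (x ∷ xs) e ys = ≋-trans (refl ∷ shift xs e ys) swap

  ++-comm : ∀ xs ys → xs ++ ys ≋ ys ++ xs
  ++-comm []       ys = ≋-reflexive (≡.sym (ListP.++-identityʳ ys))
  ++-comm (x ∷ xs) ys = ≋-trans (refl ∷ ++-comm xs ys) (≋-sym (shift ys x xs))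

  module ≋-Reasoning = Relation.Binary.Reasoning.Setoid ≋-setoid

  -- The list bookkeeping of one induction step of a splitting into three parts.
  snoc-into-three : ∀ {L X A B E f h s} → L ≋ X ++ A ++ B → E ++ f ∷ h ∷ [] ≋ s ∷ [] →
                    L ++ s ∷ [] ≋ (X ++ E) ++ (f ∷ A) ++ (B ++ h ∷ [])
  snoc-into-three {L} {X} {A} {B} {E} {f} {h} {s} L≋XAB Efh≋s = begin
      L ++ s ∷ []                         ≈⟨ ++-comm L (s ∷ []) ⟩
      s ∷ L                               ≈⟨ refl ∷ L≋XAB ⟩
      s ∷ X ++ A ++ B                     ≈⟨ shift X s (A ++ B) ⟨
      X ++ (s ∷ []) ++ A ++ B             ≈⟨ ++⁺ʳ X (++⁺ˡ (A ++ B) Efh≋s) ⟨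
      X ++ (E ++ f ∷ h ∷ []) ++ A ++ B    ≡⟨ ≡.cong (X ++_) (ListP.++-assoc E (f ∷ h ∷ []) (A ++ B)) ⟩
      X ++ E ++ f ∷ h ∷ A ++ B            ≡⟨ ListP.++-assoc X E (f ∷ h ∷ A ++ B) ⟨
      (X ++ E) ++ f ∷ h ∷ A ++ B          ≈⟨ ++⁺ʳ (X ++ E) (refl ∷ ++-comm (h ∷ []) (A ++ B)) ⟩
      (X ++ E) ++ f ∷ (A ++ B) ++ h ∷ []  ≡⟨ ≡.cong (λ t → (X ++ E) ++ f ∷ t)
                                                   (ListP.++-assoc A B (h ∷ [])) ⟩
      (X ++ E) ++ (f ∷ A) ++ (B ++ h ∷ []) ∎
    where open ≋-Reasoning

  neg⁺ : ∀ {xs ys} → xs ≋ ys → neg R xs ≋ neg R ys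
  neg⁺ []            = []
  neg⁺ (e ∷ p)       = -‿cong e ∷ neg⁺ p
  neg⁺ swap          = swap
  neg⁺ (drop-0 z)    = drop-0 (trans (-‿cong z) -0#≈0#)
  neg⁺ (≋-sym p)     = ≋-sym (neg⁺ p)
  neg⁺ (≋-trans p q) = ≋-trans (neg⁺ p) (neg⁺ q)

  map-≈ : ∀ {A : Set} {f g : A → Carrier} → (∀ i → f i ≈ g i) → ∀ xs → map f xs ≋ map g xs
  map-≈ f≈g []       = []
  map-≈ f≈g (x ∷ xs) = f≈g x ∷ map-≈ f≈g xs

  map-0 : ∀ {A : Set} {f : A → Carrier} → (∀ i → f i ≈ 0#) → ∀ xs → map f xs ≋ []
  map-0 f≈0 []       = []
  map-0 f≈0 (x ∷ xs) = ≋-trans (drop-0 (f≈0 x)) (map-0 f≈0 xs)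

  elem-resp-≋ : ∀ {xs ys} → xs ≋ ys → ∀ k → elem R k xs ≈ elem R k ys
  elem-resp-≋ []                     k             = refl
  elem-resp-≋ (e ∷ p)                zero          = refl
  elem-resp-≋ (e ∷ p)                (suc k)       =
    +-cong (elem-resp-≋ p (suc k)) (*-cong e (elem-resp-≋ p k))
  elem-resp-≋ swap                   zero          = refl
  elem-resp-≋ {x ∷ y ∷ xs} swap      (suc zero)    =
    solve 3 (λ e x y → (e :+ y :* con 1) :+ x :* con 1 := (e :+ x :* con 1) :+ y :* con 1)
      refl (elem R 1 xs) x y
  elem-resp-≋ {x ∷ y ∷ xs} swap      (suc (suc k)) =
    solve 5 (λ a b c x y → (a :+ y :* b) :+ x :* (b :+ y :* c) := (a :+ x :* b) :+ y :* (b :+ x :* c))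
      refl (elem R (suc (suc k)) xs) (elem R (suc k) xs) (elem R k xs) x y
  elem-resp-≋ (drop-0 z)             zero          = refl
  elem-resp-≋ (drop-0 z)             (suc k)       =
    trans (+-congˡ (trans (*-congʳ z) (zeroˡ _))) (+-identityʳ _)
  elem-resp-≋ (≋-sym p)              k             = sym (elem-resp-≋ p k)
  elem-resp-≋ (≋-trans p q)          k             = trans (elem-resp-≋ p k) (elem-resp-≋ q k)

  -- Cancelling x y h_k(x,y,xs) from both sides turns the symmetry in
  -- degree k + 2 into the symmetry in degrees k + 1 and k.
  hom-swap : ∀ x y xs k → hom R (x ∷ y ∷ xs) k ≈ hom R (y ∷ x ∷ xs) k
  hom-swap x y xs zero          = refl
  hom-swap x y xs (suc zero)    =
    solve 3 (λ h x y → (h :+ y :* con 1) :+ x :* con 1 := (h :+ x :* con 1) :+ y :* con 1)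
      refl (hom R xs 1) x y
  hom-swap x y xs (suc (suc k)) = ∙-cancelʳ (x * y * a) _ _ (begin
      (h + y * hy) + x * (hy + x * a) + x * y * a
    ≈⟨ solve 5 (λ h hy a x y → (h :+ y :* hy) :+ x :* (hy :+ x :* a) :+ x :* y :* a
                               := h :+ (x :+ y) :* (hy :+ x :* a)) refl h hy a x y ⟩
      h + (x + y) * (hy + x * a)
    ≈⟨ +-congˡ (*-congˡ (hom-swap x y xs (suc k))) ⟩
      h + (x + y) * (hx + y * b)
    ≈⟨ solve 5 (λ h hx b x y → h :+ (x :+ y) :* (hx :+ y :* b)
                               := (h :+ x :* hx) :+ y :* (hx :+ y :* b) :+ x :* y :* b) refl h hx b x y ⟩
      (h + x * hx) + y * (hx + y * b) + x * y * b
    ≈⟨ +-congˡ (*-congˡ (sym (hom-swap x y xs k))) ⟩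
      (h + x * hx) + y * (hx + y * b) + x * y * a ∎)
    where
    h  = hom R xs (suc (suc k))
    hy = hom R (y ∷ xs) (suc k)
    hx = hom R (x ∷ xs) (suc k)
    a  = hom R (x ∷ y ∷ xs) k
    b  = hom R (y ∷ x ∷ xs) k
    open Relation.Binary.Reasoning.Setoid setoid

  hom-resp-≋ : ∀ {xs ys} → xs ≋ ys → ∀ k → hom R xs k ≈ hom R ys k
  hom-resp-≋ []                          k = refl
  hom-resp-≋ {x ∷ xs} {y ∷ ys} (e ∷ p)   = cons
    where
    cons : ∀ k → hom R (x ∷ xs) k ≈ hom R (y ∷ ys) k
    cons zero    = refl
    cons (suc k) = +-cong (hom-resp-≋ p (suc k)) (*-cong e (cons k))
  hom-resp-≋ {x ∷ y ∷ xs} swap           k = hom-swap x y xs k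
  hom-resp-≋ {z ∷ xs} (drop-0 z≈0)       = dropped
    where
    dropped : ∀ k → hom R (z ∷ xs) k ≈ hom R xs k
    dropped zero    = refl
    dropped (suc k) = trans (+-congˡ (trans (*-congʳ z≈0) (zeroˡ _))) (+-identityʳ _)
  hom-resp-≋ (≋-sym p)                   k = sym (hom-resp-≋ p k)
  hom-resp-≋ (≋-trans p q)               k = trans (hom-resp-≋ p k) (hom-resp-≋ q k)

  sumTo-cong : ∀ {f g} → (∀ i → f i ≈ g i) → ∀ k → sumTo R f k ≈ sumTo R g k
  sumTo-cong f≈g zero    = f≈g zero
  sumTo-cong f≈g (suc k) = +-cong (sumTo-cong f≈g k) (f≈g (suc k))

  esup-resp-≋ : ∀ d {X X′ Y Y′} → X ≋ X′ → Y ≋ Y′ → esup R d X Y ≈ esup R d X′ Y′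
  esup-resp-≋ (+ k)     p q =
    sumTo-cong (λ i → *-cong (*-congˡ (elem-resp-≋ p i)) (hom-resp-≋ q (k ∸ i))) k
  esup-resp-≋ -[1+ _ ] p q = refl

module Piecewise {c ℓ} (R : CommutativeRing c ℓ) where
  import Level
  open IntegerRange
  open import Data.Nat using (zero; suc; z≤n; s≤s)
  import Data.Nat.Properties as ℕP
  open import Data.Integer using (+_; -[1+_]; _+_; _-_; -_; _≤_; _<_; _⊔_; _⊓_; +≤+; +<+)
  import Data.Integer.Properties as ℤP
  open import Data.Bool using (true; false; if_then_else_)
  open import Data.List using ([]; _∷_; _++_; map)
  import Data.List.Properties as ListP
  import Relation.Binary.PropositionalEquality as ≡
  open import Relation.Nullary using (yes; no; contradiction)
  open CommutativeRing R using (Carrier; _≈_; 0#; reflexive) renaming (sym to ≈-sym)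
  open BagModuloZeros R

  ext-nonpos : ∀ (w : ℕ → Carrier) {k} → k ≤ + 0 → ext R w k ≡ 0#
  ext-nonpos w {+ zero}   _          = ≡.refl
  ext-nonpos w { -[1+ _ ]} _         = ≡.refl
  ext-nonpos w {+ suc _}  (+≤+ ())

  sub-ext-from-1 : ∀ (w : ℕ → Carrier) {p} q → p ≤ + 1 → sub R (ext R w) p q ≋ sub R (ext R w) (+ 1) q
  sub-ext-from-1 w {p} q p≤1 = range-ind P empty snoc p q p≤1
    where
    P : ℤ → ℤ → Set _
    P p q = p ≤ + 1 → sub R (ext R w) p q ≋ sub R (ext R w) (+ 1) q
    empty : ∀ {p q} → q < p → P p q
    empty {p} {q} q<p p≤1
      rewrite range-empty q<p | range-empty (ℤP.<-≤-trans q<p p≤1) = []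
    snoc : ∀ {p q} → p ≤ q → P p (q - + 1) → P p q
    snoc {p} {q} p≤q ih p≤1 with + 1 ℤP.≤? q
    ... | yes 1≤q rewrite range-snoc p≤q | range-snoc 1≤q
                        | ListP.map-++ (ext R w) (range p (q - + 1)) (q ∷ [])
                        | ListP.map-++ (ext R w) (range (+ 1) (q - + 1)) (q ∷ [])
                        = ++⁺ˡ _ (ih p≤1)
    ... | no 1≰q rewrite range-snoc p≤q | range-empty (ℤP.≰⇒> 1≰q)
                       | ListP.map-++ (ext R w) (range p (q - + 1)) (q ∷ []) =
      ++⁺ (≋-trans (ih p≤1) (≋-reflexive (≡.cong (map (ext R w)) (range-empty (ℤP.<-trans (i-1<i q) q<1)))))
          (drop-0 (reflexive (ext-nonpos w (ℤP.i<j⇒i≤pred[j] q<1))))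
      where
      q<1 : q < + 1
      q<1 = ℤP.≰⇒> 1≰q

  module _ (m : ℕ) (F G H : ℕ → Carrier) where

    -- The shape of both g-specialisations: F reflected onto k ≤ 0, G on [1, m], H shifted onto k > m.
    piecewise : ℤ → Carrier
    piecewise (+ zero)  = F 1
    piecewise -[1+ k ]  = F (suc (suc k))
    piecewise (+ suc k) = if suc k ℕ.≤ᵇ m then G (suc k) else H (suc k ℕ.∸ m)

    piecewise-nonpos : ∀ {k} → k ≤ + 0 → piecewise k ≡ ext R F (τ k)
    piecewise-nonpos {+ zero}   _        = ≡.refl
    piecewise-nonpos { -[1+ k ]} _       = ≡.cong (λ t → F (suc t)) (≡.sym (ℕP.+-comm k 1))
    piecewise-nonpos {+ suc _}  (+≤+ ())

    piecewise-middle : ∀ {k} → + 1 ≤ k → k ≤ + m → piecewise k ≡ ext R G k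
    piecewise-middle {+ zero}  (+≤+ ()) _
    piecewise-middle {+ suc k} _ k≤m with suc k ℕ.≤ᵇ m | ℕP.≤⇒≤ᵇ (ℤP.drop‿+≤+ k≤m)
    ... | true | _ = ≡.refl

    piecewise-above : ∀ {k} → + m < k → piecewise k ≡ ext R H (η m k)
    piecewise-above {+ zero}  (+<+ ())
    piecewise-above {+ suc k} m<k with suc k ℕ.≤ᵇ m | ℕP.≤ᵇ⇒≤ (suc k) m
    ... | true  | k<m = contradiction (k<m _) (ℕP.<⇒≱ (ℤP.drop‿+<+ m<k))
    ... | false | _   = ≡.trans (≡.cong H (ℕP.+-∸-assoc 1 m≤k)) (≡.cong (ext R H) (≡.sym η[k]))
      where
      m≤k : m ℕ.≤ k
      m≤k = ℕP.≤-pred (ℤP.drop‿+<+ m<k)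
      η[k] : η m (+ suc k) ≡ + suc (k ℕ.∸ m)
      η[k] = ≡.trans (ℤP.m-n≡m⊖n (suc k) m)
               (≡.trans (ℤP.⊖-≥ (ℕP.m≤n⇒m≤1+n m≤k)) (≡.cong +_ (ℕP.+-∸-assoc 1 m≤k)))

    middle low high : ℤ → ℤ → List Carrier
    middle a b = sub R (ext R G) (+ 1 ⊔ a) (+ m ⊓ b)
    low    a b = sub R (ext R F) (τ b) (τ a)
    high   a b = sub R (ext R H) (η m a) (η m b)

    low-peel : ∀ {a b} → a ≤ b → low a b ≡ ext R F (τ b) ∷ low a (b - + 1)
    low-peel {a} {b} a≤b = ≡.cong (map (ext R F)) (≡.trans
      (range-cons (ℤP.+-monoˡ-≤ (+ 1) (ℤP.neg-mono-≤ a≤b)))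
      (≡.cong (λ t → τ b ∷ range t (τ a)) (τ-pred b)))

    high-peel : ∀ {a b} → a ≤ b → high a b ≡ high a (b - + 1) ++ ext R H (η m b) ∷ []
    high-peel {a} {b} a≤b = ≡.trans (≡.cong (map (ext R H)) (≡.trans
      (range-snoc (ℤP.+-monoˡ-≤ (- + m) a≤b))
      (≡.cong (λ t → range (η m a) t ++ η m b ∷ []) (η-pred m b))))
      (ListP.map-++ (ext R H) (range (η m a) (η m (b - + 1))) (η m b ∷ []))

    low-vanishes : ∀ {b} → + 1 ≤ b → ext R F (τ b) ≡ 0#
    low-vanishes {b} 1≤b = ext-nonpos F
      (ℤP.≤-trans (ℤP.≤-reflexive (ℤP.+-comm (- b) (+ 1))) (ℤP.i≤j⇒i-j≤0 1≤b))

    high-vanishes : ∀ {b} → b ≤ + m → ext R H (η m b) ≡ 0#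
    high-vanishes b≤m = ext-nonpos H (ℤP.i≤j⇒i-j≤0 b≤m)

    middle-empty : ∀ {a b} → b < + 1 → middle a b ≡ []
    middle-empty {a} {b} b<1 = ≡.cong (map (ext R G))
      (range-empty (ℤP.≤-<-trans (ℤP.i⊓j≤j (+ m) b) (ℤP.<-≤-trans b<1 (ℤP.i≤i⊔j (+ 1) a))))

    middle-snoc : ∀ {a b} → + 1 ≤ b → b ≤ + m → a ≤ b → middle a b ≡ middle a (b - + 1) ++ ext R G b ∷ []
    middle-snoc {a} {b} 1≤b b≤m a≤b
      rewrite ℤP.i≥j⇒i⊓j≡j b≤m | ℤP.i≥j⇒i⊓j≡j (ℤP.≤-trans (ℤP.<⇒≤ (i-1<i b)) b≤m)
      = ≡.trans (≡.cong (map (ext R G)) (range-snoc (ℤP.⊔-lub 1≤b a≤b)))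
                (ListP.map-++ (ext R G) (range (+ 1 ⊔ a) (b - + 1)) (b ∷ []))

    middle-above : ∀ {a b} → + m < b → middle a b ≡ middle a (b - + 1) ++ []
    middle-above {a} {b} m<b = ≡.trans
      (≡.cong (sub R (ext R G) (+ 1 ⊔ a))
        (≡.trans (ℤP.i≤j⇒i⊓j≡i (ℤP.<⇒≤ m<b)) (≡.sym (ℤP.i≤j⇒i⊓j≡i (i<j⇒i≤j-1 m<b)))))
      (≡.sym (ListP.++-identityʳ _))

    Splits : ℤ → ℤ → Set (c Level.⊔ ℓ)
    Splits a b = sub R piecewise a b ≋ middle a b ++ low a b ++ high a b

    splits-empty : ∀ {a b} → b < a → Splits a b
    splits-empty {a} {b} b<a
      rewrite range-empty b<a
            | range-empty (ℤP.≤-<-trans (ℤP.i⊓j≤j (+ m) b) (ℤP.<-≤-trans b<a (ℤP.i≤j⊔i (+ 1) a)))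
            | range-empty (τ-antitone b<a)
            | range-empty (η-monotone m b<a) = []

    splits-step-with : ∀ {a b} E → a ≤ b → middle a b ≡ middle a (b - + 1) ++ E →
                E ++ ext R F (τ b) ∷ ext R H (η m b) ∷ [] ≋ piecewise b ∷ [] →
                Splits a (b - + 1) → Splits a b
    splits-step-with {a} {b} E a≤b middle-peel pieces ih =
      ≋-trans (≋-reflexive (≡.trans (≡.cong (map piecewise) (range-snoc a≤b))
                                    (ListP.map-++ piecewise (range a (b - + 1)) (b ∷ []))))
        (≋-trans (snoc-into-three {X = middle a (b - + 1)} {A = low a (b - + 1)} {B = high a (b - + 1)} ih pieces)
          (≋-reflexive (≡.sym (≡.cong₂ _++_ middle-peel (≡.cong₂ _++_ (low-peel a≤b) (high-peel a≤b))))))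

    -- The new entry piecewise b lands in exactly one of the three parts; the other two gain a zero.
    splits-step : ∀ {a b} → a ≤ b → Splits a (b - + 1) → Splits a b
    splits-step {a} {b} a≤b with b ℤP.≤? + 0
    ... | yes b≤0 = splits-step-with [] a≤b
        (≡.trans (middle-empty b<1)
          (≡.sym (≡.trans (ListP.++-identityʳ _) (middle-empty (ℤP.<-trans (i-1<i b) b<1)))))
        (≈-sym (reflexive (piecewise-nonpos b≤0))
          ∷ drop-0 (reflexive (high-vanishes (ℤP.≤-trans b≤0 (+≤+ z≤n)))))
      where
      b<1 : b < + 1
      b<1 = ℤP.≤-<-trans b≤0 (+<+ (s≤s z≤n))
    ... | no b≰0 with b ℤP.≤? + m
    ...   | yes b≤m = splits-step-with (ext R G b ∷ []) a≤b (middle-snoc 1≤b b≤m a≤b)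
        (≈-sym (reflexive (piecewise-middle 1≤b b≤m))
          ∷ ≋-trans (drop-0 (reflexive (low-vanishes 1≤b))) (drop-0 (reflexive (high-vanishes b≤m))))
      where
      1≤b : + 1 ≤ b
      1≤b = ℤP.i<j⇒suc[i]≤j (ℤP.≰⇒> b≰0)
    ...   | no b≰m  = splits-step-with [] a≤b (middle-above m<b)
        (≋-trans (drop-0 (reflexive (low-vanishes 1≤b))) (≈-sym (reflexive (piecewise-above m<b)) ∷ []))
      where
      1≤b : + 1 ≤ b
      1≤b = ℤP.i<j⇒suc[i]≤j (ℤP.≰⇒> b≰0)
      m<b : + m < b
      m<b = ℤP.≰⇒> b≰m

    sub-piecewise : ∀ a b → sub R piecewise a b ≋ middle a b ++ low a b ++ high a b
    sub-piecewise = range-ind Splits splits-empty splits-step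

module Determinant {c ℓ} (R : CommutativeRing c ℓ) where
  open import Data.Nat using (zero; suc; _≤_; _<_; z≤n; s≤s)
  import Data.Nat.Properties as ℕP
  open import Data.Fin using (Fin; toℕ; punchIn) renaming (zero to fzero; suc to fsuc)
  open import Data.Sum using (_⊎_; inj₁; inj₂)
  import Relation.Binary.PropositionalEquality as ≡

  toℕ-punchIn≤ : ∀ {n} (j : Fin (suc n)) (k : Fin n) → toℕ (punchIn j k) ≤ suc (toℕ k)
  toℕ-punchIn≤ fzero    k        = ℕP.≤-refl
  toℕ-punchIn≤ (fsuc j) fzero    = z≤n
  toℕ-punchIn≤ (fsuc j) (fsuc k) = s≤s (toℕ-punchIn≤ j k)

  punchIn-shifts⊎fixes : ∀ {n} (j : Fin (suc n)) (k : Fin n) →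
                         punchIn j k ≡ fsuc k ⊎ toℕ (punchIn j k) ≡ toℕ k
  punchIn-shifts⊎fixes fzero    k        = inj₁ ≡.refl
  punchIn-shifts⊎fixes (fsuc j) fzero    = inj₂ ≡.refl
  punchIn-shifts⊎fixes (fsuc j) (fsuc k) with punchIn-shifts⊎fixes j k
  ... | inj₁ e = inj₁ (≡.cong fsuc e)
  ... | inj₂ e = inj₂ (≡.cong suc e)

  toℕ-punchIn-suc-self : ∀ {n} (j : Fin n) → toℕ (punchIn (fsuc j) j) ≡ toℕ j
  toℕ-punchIn-suc-self fzero    = ≡.refl
  toℕ-punchIn-suc-self (fsuc j) = ≡.cong suc (toℕ-punchIn-suc-self j)
  open CommutativeRing R hiding (zero)
  open import Relation.Binary.Reasoning.Setoid setoid

  Matrix : ℕ → Set c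
  Matrix n = Fin n → Fin n → Carrier

  minor : ∀ {n} → Matrix (suc n) → Fin (suc n) → Matrix n
  minor M j i k = M (fsuc i) (punchIn j k)

  diagonalProduct : ∀ n → Matrix n → Carrier
  diagonalProduct zero    M = 1#
  diagonalProduct (suc n) M = M fzero fzero * diagonalProduct n (λ i k → M (fsuc i) (fsuc k))

  ZeroBelowDiagonalFrom : ∀ {n} → ℕ → Matrix n → Set ℓ
  ZeroBelowDiagonalFrom L M = ∀ i j → L ≤ toℕ i → toℕ j < toℕ i → M i j ≈ 0#

  sumFin-cong : ∀ {n} {f g : Fin n → Carrier} → (∀ j → f j ≈ g j) → sumFin R f ≈ sumFin R g
  sumFin-cong {zero}  f≈g = refl
  sumFin-cong {suc n} f≈g = +-cong (f≈g fzero) (sumFin-cong (λ j → f≈g (fsuc j)))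

  sumFin-zero : ∀ {n} (f : Fin n → Carrier) → (∀ j → f j ≈ 0#) → sumFin R f ≈ 0#
  sumFin-zero {zero}  f f≈0 = refl
  sumFin-zero {suc n} f f≈0 =
    trans (+-cong (f≈0 fzero) (sumFin-zero (λ j → f (fsuc j)) (λ j → f≈0 (fsuc j)))) (+-identityˡ 0#)

  det-cong : ∀ n {M N : Matrix n} → (∀ i j → M i j ≈ N i j) → det R n M ≈ det R n N
  det-cong zero    M≈N = refl
  det-cong (suc n) M≈N = sumFin-cong (λ j →
    *-cong (*-congˡ {sign R (toℕ j)} (M≈N fzero j)) (det-cong n (λ i k → M≈N (fsuc i) (punchIn j k))))

  diagonalProduct-zero : ∀ n (M : Matrix n) i → M i i ≈ 0# → diagonalProduct n M ≈ 0#
  diagonalProduct-zero (suc n) M fzero    Mii≈0 = trans (*-congʳ Mii≈0) (zeroˡ _)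
  diagonalProduct-zero (suc n) M (fsuc i) Mii≈0 =
    trans (*-congˡ (diagonalProduct-zero n _ i Mii≈0)) (zeroʳ _)

  diagonalProduct-cong : ∀ n {M N : Matrix n} → (∀ i → M i i ≈ N i i) →
                         diagonalProduct n M ≈ diagonalProduct n N
  diagonalProduct-cong zero    Mii≈Nii = refl
  diagonalProduct-cong (suc n) Mii≈Nii =
    *-cong (Mii≈Nii fzero) (diagonalProduct-cong n (λ i → Mii≈Nii (fsuc i)))

  minor-zeroBelowDiagonal : ∀ {n} L (M : Matrix (suc n)) j →
    ZeroBelowDiagonalFrom (suc L) M → ZeroBelowDiagonalFrom L (minor M j)
  minor-zeroBelowDiagonal L M j M↓ i k L≤i k<i =
    M↓ (fsuc i) (punchIn j k) (s≤s L≤i) (ℕP.≤-trans (s≤s (toℕ-punchIn≤ j k)) (s≤s k<i))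

  det-upperTriangular : ∀ n (M : Matrix n) → ZeroBelowDiagonalFrom 0 M → det R n M ≈ diagonalProduct n M
  det-upperTriangular zero    M M↓ = refl
  det-upperTriangular (suc n) M M↓ = begin
      sumFin R (λ j → sign R (toℕ j) * M fzero j * det R n (minor M j))
    ≈⟨ +-congˡ (sumFin-zero _ (λ j → trans (*-congˡ (minor-singular j)) (zeroʳ _))) ⟩
      1# * M fzero fzero * det R n (minor M fzero) + 0#
    ≈⟨ +-identityʳ _ ⟩
      1# * M fzero fzero * det R n (minor M fzero)
    ≈⟨ *-cong (*-identityˡ _) (det-upperTriangular n (minor M fzero) (minor↓ fzero)) ⟩
      diagonalProduct (suc n) M ∎
    where
    minor↓ : ∀ j → ZeroBelowDiagonalFrom 0 (minor M j)
    minor↓ j = minor-zeroBelowDiagonal 0 M j (λ i k _ → M↓ i k z≤n)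
    -- deleting column j + 1 leaves the entry M (j+1) j on the diagonal of the minor
    minor-singular : ∀ j → det R n (minor M (fsuc j)) ≈ 0#
    minor-singular j = trans (det-upperTriangular n _ (minor↓ (fsuc j)))
      (diagonalProduct-zero n _ j (M↓ (fsuc j) _ z≤n
        (≡.subst (_< suc (toℕ j)) (≡.sym (toℕ-punchIn-suc-self j)) ℕP.≤-refl)))

  -- Expanding along the L agreeing rows leaves upper triangular minors with equal diagonals.
  det-cong-blockTriangular : ∀ n L (M N : Matrix n) →
    (∀ i j → toℕ i < L → M i j ≈ N i j) →
    ZeroBelowDiagonalFrom L M → ZeroBelowDiagonalFrom L N →
    (∀ i → L ≤ toℕ i → M i i ≈ N i i) → det R n M ≈ det R n N
  det-cong-blockTriangular zero    L       M N rows M↓ N↓ diag = refl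
  det-cong-blockTriangular (suc n) zero    M N rows M↓ N↓ diag = begin
    det R (suc n) M            ≈⟨ det-upperTriangular (suc n) M M↓ ⟩
    diagonalProduct (suc n) M  ≈⟨ diagonalProduct-cong (suc n) {M} {N} (λ i → diag i z≤n) ⟩
    diagonalProduct (suc n) N  ≈⟨ det-upperTriangular (suc n) N N↓ ⟨
    det R (suc n) N            ∎
  det-cong-blockTriangular (suc n) (suc L) M N rows M↓ N↓ diag =
    sumFin-cong (λ j → *-cong (*-congˡ {sign R (toℕ j)} (rows fzero j (s≤s z≤n)))
      (det-cong-blockTriangular n L (minor M j) (minor N j)
        (λ i k i<L → rows (fsuc i) (punchIn j k) (s≤s i<L))
        (minor-zeroBelowDiagonal L M j M↓) (minor-zeroBelowDiagonal L N j N↓)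
        (minor-diagonal j)))
    where
    minor-diagonal : ∀ j i → L ≤ toℕ i → minor M j i i ≈ minor N j i i
    minor-diagonal j i L≤i with punchIn-shifts⊎fixes j i
    ... | inj₁ e rewrite e = diag (fsuc i) (s≤s L≤i)
    ... | inj₂ e = trans (M↓ (fsuc i) (punchIn j i) (s≤s L≤i) below)
                         (sym (N↓ (fsuc i) (punchIn j i) (s≤s L≤i) below))
      where
      below : toℕ (punchIn j i) < suc (toℕ i)
      below = ≡.subst (_< suc (toℕ i)) (≡.sym e) ℕP.≤-refl

module Conjugate where
  open import Data.Nat using (suc; _≤_; _<_; _≥_; z≤n; s≤s; _≤?_)
  import Data.Nat.Properties as ℕP
  open import Data.List using ([]; _∷_; length)
  import Data.List.Properties as ListP
  import Data.List.Relation.Unary.All as All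
  open import Data.List.Relation.Unary.Linked using (Linked)
  open import Data.List.Relation.Unary.Linked.Properties using (Linked⇒All)
  import Relation.Binary.PropositionalEquality as ≡

  conj-vanishes : ∀ {l i} → Linked _≥_ l → part l 1 < i → conj l i ≡ 0
  conj-vanishes {[]}     _  _   = ≡.refl
  conj-vanishes {x ∷ xs} lk x<i = ≡.cong length (ListP.filter-none (_ ≤?_)
    (All.map (λ p≤x i≤p → ℕP.<⇒≱ (ℕP.≤-<-trans p≤x x<i) i≤p)
      (Linked⇒All (λ x≥y y≥z → ℕP.≤-trans y≥z x≥y) ℕP.≤-refl lk)))

  0<conj : ∀ l i → suc i ≤ part l 1 → 0 < conj l (suc i)
  0<conj (x ∷ xs) i i<x rewrite ListP.filter-accept (suc i ≤?_) {x} {xs} i<x = s≤s z≤n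

module StandardFlags where
  open IntegerRange
  open import Data.Nat using (suc; z≤n)
  open import Data.Integer using (+_; _+_; _-_; -_; _≤_; _<_; +≤+; +<+)
  import Data.Integer.Properties as ℤP
  open import Data.Integer.Tactic.RingSolver using (solve-∀)
  import Relation.Binary.PropositionalEquality as ≡

  standardA : ℕ → ℤ
  standardA i = - + i + + 2

  standardB : List ℕ → ℕ → ℕ → ℤ
  standardB lam m i = + conj lam i + + m - + 1

  τ[+k]≤1 : ∀ k → τ (+ k) ≤ + 1
  τ[+k]≤1 k = ℤP.+-monoˡ-≤ (+ 1) (ℤP.neg-mono-≤ {+ 0} {+ k} (+≤+ z≤n))

  standardA≤1 : ∀ j → standardA (suc j) ≤ + 1
  standardA≤1 j = ℤP.≤-trans (ℤP.≤-reflexive (identity (+ j))) (ℤP.i-j≤i (+ 1) (+ j))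
    where
    identity : ∀ J → - (+ 1 + J) + + 2 ≡ + 1 - J
    identity = solve-∀

  τ-standardA : ∀ j → τ (standardA (suc j)) ≡ + j
  τ-standardA j = identity (+ suc j)
    where
    identity : ∀ J → - (- J + + 2) + + 1 ≡ J - + 1
    identity = solve-∀

  τ[1-u]≡u : ∀ u → τ (+ 1 - + u) ≡ + u
  τ[1-u]≡u u = identity (+ u)
    where
    identity : ∀ U → - (+ 1 - U) + + 1 ≡ U
    identity = solve-∀

  η[l+m]≡l : ∀ m l → η m (+ l + + m) ≡ + l
  η[l+m]≡l m l = identity (+ l) (+ m)
    where
    identity : ∀ L M → L + M - M ≡ L
    identity = solve-∀

  i≤1⇒η[i]≤1 : ∀ m {k} → k ≤ + 1 → η m k ≤ + 1
  i≤1⇒η[i]≤1 m k≤1 = ℤP.≤-trans (ℤP.i-j≤i _ (+ m)) k≤1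

  conjFlagA-standard : ∀ lam mu r → r ≡ + 1 - + conj lam 1 →
                       ∀ j → conjFlagA lam mu r standardA j ≡ + 1 - + conj mu j
  conjFlagA-standard lam mu _ ≡.refl j = identity (+ j) (+ conj mu j) (+ conj lam 1)
    where
    identity : ∀ J U Λ → (- J + + 2) + (J - (+ 1 + U) + (+ 1 - Λ) - + 1 + Λ) ≡ + 1 - U
    identity = solve-∀

  conjFlagB-standard : ∀ lam m r → r ≡ + 1 - + conj lam 1 →
                       ∀ i → conjFlagB lam r (standardB lam m) i ≡ + i + + m - + 1
  conjFlagB-standard lam m _ ≡.refl i = identity (+ conj lam i) (+ m) (+ i) (+ conj lam 1)
    where
    identity : ∀ Λᵢ M I Λ → (Λᵢ + M - + 1) + (I - Λᵢ + (+ 1 - Λ) - + 1 + Λ) ≡ I + M - + 1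
    identity = solve-∀

  degree-below : ∀ {c ℓ} (R : CommutativeRing c ℓ) lam mu {i j} → conj lam i ≡ 0 → j ℕ.< i →
                 degree R lam mu i j < + 0
  degree-below R lam mu {i} {j} λᵢ≡0 j<i rewrite λᵢ≡0 =
    ℤP.≤-<-trans (ℤP.≤-reflexive (identity (+ i) (+ conj mu j) (+ j)))
      (ℤP.≤-<-trans (ℤP.i-j≤i (+ j - + i) (+ conj mu j))
        (≡.subst (+ j - + i <_) (ℤP.+-inverseʳ (+ i)) (ℤP.+-monoˡ-< (- + i) (+<+ j<i))))
    where
    identity : ∀ I U J → + 0 - I - U + J ≡ (J - I) - U
    identity = solve-∀

  degree-diagonal : ∀ {c ℓ} (R : CommutativeRing c ℓ) lam mu {i} → conj lam i ≡ 0 → conj mu i ≡ 0 →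
                    degree R lam mu i i ≡ + 0
  degree-diagonal R lam mu {i} λᵢ≡0 μᵢ≡0 rewrite λᵢ≡0 | μᵢ≡0 = identity (+ i)
    where
    identity : ∀ I → + 0 - I - + 0 + I ≡ + 0
    identity = solve-∀

module Specialisation {c ℓ} (R : CommutativeRing c ℓ) (m : ℕ) (x α β : ℕ → CommutativeRing.Carrier R) where
  open IntegerRange
  open import Data.Nat using (zero; suc; s≤s)
  import Data.Nat.Properties as ℕP
  open import Data.Integer using (+_; -[1+_]; _+_; _-_; _≤_; _<_; _⊔_; _⊓_; +≤+; +<+)
  import Data.Integer.Properties as ℤP
  open import Data.List using (_++_)
  import Data.List.Properties as ListP
  open import Data.Fin using (toℕ)
  import Relation.Binary.PropositionalEquality as ≡
  open Conjugate
  open StandardFlags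
  open CommutativeRing R using (Carrier; _≈_; 0#; 1#; refl; sym; trans; reflexive; *-identityʳ)
    renaming (-_ to -ᴿ_)
  open BagModuloZeros R
  open Piecewise R
  open Determinant R

  ySpec-piecewise : ∀ k → ySpec R m x α β k ≡ piecewise m (λ i → -ᴿ α i) x β k
  ySpec-piecewise (+ zero)  = ≡.refl
  ySpec-piecewise (+ suc _) = ≡.refl
  ySpec-piecewise -[1+ _ ]  = ≡.refl

  zSpec-piecewise : ∀ k → zSpec R m x α β k ≡ piecewise m β (λ _ → 0#) (λ i → -ᴿ α i) k
  zSpec-piecewise (+ zero)  = ≡.refl
  zSpec-piecewise (+ suc _) = ≡.refl
  zSpec-piecewise -[1+ _ ]  = ≡.refl

  sub-ext-neg : ∀ (w : ℕ → Carrier) p q → sub R (ext R (λ i → -ᴿ w i)) p q ≋ neg R (sub R (ext R w) p q)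
  sub-ext-neg w p q = ≋-trans (map-≈ ext-neg (range p q)) (≋-reflexive (ListP.map-∘ (range p q)))
    where
    open import Algebra.Properties.Ring (CommutativeRing.ring R) using (-0#≈0#)
    ext-neg : ∀ k → ext R (λ i → -ᴿ w i) k ≈ -ᴿ ext R w k
    ext-neg (+ zero)  = sym -0#≈0#
    ext-neg (+ suc _) = refl
    ext-neg -[1+ _ ]  = sym -0#≈0#

  sub-ySpec : ∀ a b → sub R (ySpec R m x α β) a b ≋
    sub R (ext R x) (+ 1 ⊔ a) (+ m ⊓ b) ++ neg R (sub R (ext R α) (τ b) (τ a)) ++ sub R (ext R β) (η m a) (η m b)
  sub-ySpec a b = ≋-trans (≋-reflexive (ListP.map-cong ySpec-piecewise (range a b)))
    (≋-trans (sub-piecewise m (λ i → -ᴿ α i) x β a b)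
      (++⁺ʳ (sub R (ext R x) (+ 1 ⊔ a) (+ m ⊓ b))
        (++⁺ˡ (sub R (ext R β) (η m a) (η m b)) (sub-ext-neg α (τ b) (τ a)))))

  sub-zSpec : ∀ a b → sub R (zSpec R m x α β) a b ≋
    neg R (sub R (ext R α) (η m a) (η m b)) ++ sub R (ext R β) (τ b) (τ a)
  sub-zSpec a b = ≋-trans (≋-reflexive (ListP.map-cong zSpec-piecewise (range a b)))
    (≋-trans (sub-piecewise m β (λ _ → 0#) (λ i → -ᴿ α i) a b)
    (≋-trans (++⁺ˡ (sub R (ext R β) (τ b) (τ a) ++ sub R (ext R (λ i → -ᴿ α i)) (η m a) (η m b))
                   (map-0 ext-0 (range (+ 1 ⊔ a) (+ m ⊓ b))))
    (≋-trans (++-comm (sub R (ext R β) (τ b) (τ a)) _)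
             (++⁺ˡ (sub R (ext R β) (τ b) (τ a)) (sub-ext-neg α (η m a) (η m b))))))
    where
    ext-0 : ∀ k → ext R (λ _ → 0#) k ≈ 0#
    ext-0 (+ zero)  = refl
    ext-0 (+ suc _) = refl
    ext-0 -[1+ _ ]  = refl

  gFlag≈gFlagRHS : ∀ lam mu r n a b → gFlag R lam mu r n a b m x α β ≈ gFlagRHS R lam mu r n a b m x α β
  gFlag≈gFlagRHS lam mu r n a b = det-cong n (λ i j →
    esup-resp-≋ (degree R lam mu (ix R i) (ix R j))
      (sub-ySpec (a (ix R j)) (b (ix R i)))
      (sub-zSpec (conjFlagA lam mu r a (ix R j)) (conjFlagB lam r b (ix R i))))

  sub-ext-from-1′ : ∀ (w : ℕ → Carrier) {p q q′} → p ≤ + 1 → q ≡ q′ →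
                    sub R (ext R w) p q ≋ sub R (ext R w) (+ 1) q′
  sub-ext-from-1′ w {q = q} p≤1 ≡.refl = sub-ext-from-1 w q p≤1

  sub-ySpec-standard : ∀ j {Λ} → 0 ℕ.< Λ → sub R (ySpec R m x α β) (standardA (suc j)) (+ Λ + + m - + 1) ≋
    sub R (ext R x) (+ 1) (+ m) ++ neg R (sub R (ext R α) (+ 1) (+ j)) ++ sub R (ext R β) (+ 1) (+ Λ - + 1)
  sub-ySpec-standard j {suc l} _ = ≋-trans (sub-ySpec (standardA (suc j)) (+ suc l + + m - + 1)) (++⁺
    (≋-reflexive (≡.cong₂ (sub R (ext R x))
      (ℤP.i≥j⇒i⊔j≡i (standardA≤1 j)) (ℤP.i≤j⇒i⊓j≡i (+≤+ (ℕP.m≤n+m m l)))))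
    (++⁺ (neg⁺ (sub-ext-from-1′ α (τ[+k]≤1 (l ℕ.+ m)) (τ-standardA j)))
         (sub-ext-from-1′ β (i≤1⇒η[i]≤1 m (standardA≤1 j)) (η[l+m]≡l m l))))

  sub-zSpec-standard : ∀ i u → sub R (zSpec R m x α β) (+ 1 - + u) (+ suc i + + m - + 1) ≋
    neg R (sub R (ext R α) (+ 1) (+ i)) ++ sub R (ext R β) (+ 1) (+ u)
  sub-zSpec-standard i u = ≋-trans (sub-zSpec (+ 1 - + u) (+ suc i + + m - + 1)) (++⁺
    (neg⁺ (sub-ext-from-1′ α (i≤1⇒η[i]≤1 m (ℤP.i-j≤i (+ 1) (+ u))) (η[l+m]≡l m i)))
    (sub-ext-from-1′ β (τ[+k]≤1 (i ℕ.+ m)) (τ[1-u]≡u u)))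

  esup-negative : ∀ {d} X Y → d < + 0 → esup R d X Y ≈ 0#
  esup-negative {+ zero}    _ _ (+<+ ())
  esup-negative { -[1+ _ ]} _ _ _ = refl

  esup-zero : ∀ {d} X Y → d ≡ + 0 → esup R d X Y ≈ 1#
  esup-zero _ _ ≡.refl = trans (*-identityʳ _) (*-identityʳ _)

  gFlag-standard≈gDual : ∀ lam mu r n → IsPartition lam → IsPartition mu → mu ⊆ₚ lam →
    r ≡ + 1 - + conj lam 1 →
    gFlag R lam mu r n standardA (standardB lam m) m x α β ≈ gDual R lam mu n m x α β
  gFlag-standard≈gDual lam mu r n (lam-decreasing , _) (mu-decreasing , _) mu⊆lam r≡ =
    det-cong-blockTriangular n (part lam 1) _ _
      (λ i j i<λ₁ → esup-resp-≋ (degree R lam mu (ix R i) (ix R j))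
        (sub-ySpec-standard (toℕ j) (0<conj lam (toℕ i) i<λ₁))
        (≋-trans (≋-reflexive (≡.cong₂ (sub R (zSpec R m x α β))
                   (conjFlagA-standard lam mu r r≡ (ix R j)) (conjFlagB-standard lam m r r≡ (ix R i))))
                 (sub-zSpec-standard (toℕ i) (conj mu (ix R j)))))
      (λ i j λ₁≤i j<i → esup-negative _ _ (degree-below R lam mu (λ-vanishes λ₁≤i) (s≤s j<i)))
      (λ i j λ₁≤i j<i → esup-negative _ _ (degree-below R lam mu (λ-vanishes λ₁≤i) (s≤s j<i)))
      (λ i λ₁≤i → let d≡0 = degree-diagonal R lam mu (λ-vanishes λ₁≤i) (μ-vanishes λ₁≤i)
                  in trans (esup-zero _ _ d≡0) (sym (esup-zero _ _ d≡0)))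
    where
    λ-vanishes : ∀ {i} → part lam 1 ℕ.≤ i → conj lam (suc i) ≡ 0
    λ-vanishes λ₁≤i = conj-vanishes lam-decreasing (s≤s λ₁≤i)
    μ-vanishes : ∀ {i} → part lam 1 ℕ.≤ i → conj mu (suc i) ≡ 0
    μ-vanishes λ₁≤i = conj-vanishes mu-decreasing (ℕP.≤-<-trans (mu⊆lam 1) (s≤s λ₁≤i))

mainTheorem2 : ∀ {c ℓ} (R : CommutativeRing c ℓ) (m : ℕ) (lam mu : List ℕ) (r : ℤ) (n : ℕ)
    (x α β : ℕ → CommutativeRing.Carrier R) →
    IsPartition lam → IsPartition mu → mu ⊆ₚ lam → part lam 1 ℕ.≤ n →
    (∀ (a b : ℕ → ℤ) → ColumnFlags lam mu n a b →
      CommutativeRing._≈_ R (gFlag R lam mu r n a b m x α β) (gFlagRHS R lam mu r n a b m x α β))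
    × (r ≡ ℤ.+ 1 ℤ.- ℤ.+ conj lam 1 →
      CommutativeRing._≈_ R
        (flaggedS R lam mu r n (λ i → ℤ.- ℤ.+ i ℤ.+ ℤ.+ 2) (λ i → ℤ.+ conj lam i ℤ.+ ℤ.+ m ℤ.- ℤ.+ 1)
          (ySpec R m x α β) (zSpec R m x α β))
        (gFlag R lam mu r n (λ i → ℤ.- ℤ.+ i ℤ.+ ℤ.+ 2) (λ i → ℤ.+ conj lam i ℤ.+ ℤ.+ m ℤ.- ℤ.+ 1) m x α β)
      × CommutativeRing._≈_ R
        (gFlag R lam mu r n (λ i → ℤ.- ℤ.+ i ℤ.+ ℤ.+ 2) (λ i → ℤ.+ conj lam i ℤ.+ ℤ.+ m ℤ.- ℤ.+ 1) m x α β)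
        (gDual R lam mu n m x α β))
mainTheorem2 R m lam mu r n x α β lam-partition mu-partition mu⊆lam _ =
  (λ a b _ → gFlag≈gFlagRHS lam mu r n a b) ,
  (λ r≡ → refl , gFlag-standard≈gDual lam mu r n lam-partition mu-partition mu⊆lam r≡)
  where
  open Specialisation R m x α β
  open CommutativeRing R using (refl)
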